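{- Let $w$ and $v$ be two words of the same length $n$ over some alphabet, and let $p,q$ be positive integers such that $w$ has period $q$ and $v$ has period $p$. Assume that $w$ and $v$ coincide except possibly in one position, i.e., there is an index $t$ with $1\leqslant t\leqslant n$ such that $w_i=v_i$ for all $i\neq t$, $1\leqslant i\leqslant n$. If $\max\{p,q\}\leqslant \left\lfloor \frac{n}{2}\right\rfloor$, then $w=v$.
   Context: A word $u=u_1u_2\cdots u_n$ of length $n$ has period $p$ (a positive integer) if $u_i=u_{i+p}$ for all $i$ with $1\leqslant i\leqslant n-p$. -}

module Defs where

open import Data.Nat using (ℕ; _+_; _<_)
open import Data.Fin using (Fin; toℕ)
open import Relation.Binary.PropositionalEquality using (_≡_)

-- A word of length n over alphabet A, positions 0-indexed (position i here
-- corresponds to u_{i+1} in the paper).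
Word : ∀ {a} → Set a → ℕ → Set a
Word A n = Fin n → A

HasPeriod : ∀ {a} {A : Set a} {n : ℕ} → Word A n → ℕ → Set a
HasPeriod {n = n} u p =
  (i j : Fin n) → toℕ j ≡ toℕ i + p → u i ≡ u j

-- Take the q-periodic extension E of w to all of ℕ.  Every position i with
-- i, i + p both different from t gives w i = v i = v (i + p) = w (i + p), i.e.
-- E links the residue of i mod q to that of i + p.  Because n ≥ 2 max(p, q),
-- every residue can be linked this way except at most one, and the missing link
-- is forced by going once around the cycle of residues s, s + p, s + 2p, … mod q.
-- So w also has period p, and then w and v agree at t via a neighbour t ± p.

module Submission where

open import Defs
open import Data.Nat using (ℕ; _⊔_; _≤_; _/_; NonZero)
open import Data.Fin using (Fin)
open import Relation.Binary.PropositionalEquality using (_≡_)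
open import Relation.Nullary using (¬_)

open import Data.Nat using (zero; suc; _+_; _*_; _∸_; _<_; _%_; pred; _<?_; _≟_; >-nonZero⁻¹)
open import Data.Nat.Properties
open import Data.Nat.DivMod
open import Data.Fin as Fin using (toℕ; fromℕ<)
open import Data.Fin.Properties using (toℕ-fromℕ<; fromℕ<-cong; toℕ<n; toℕ-injective)
open import Data.Product using (Σ; _,_)
open import Data.Sum using (_⊎_; inj₁; inj₂)
open import Data.Empty using (⊥-elim)
open import Relation.Binary.PropositionalEquality using (refl; sym; trans; cong; _≢_; module ≡-Reasoning)
open import Relation.Nullary using (yes; no)

%-cong-+ʳ : ∀ {x y} p q .{{_ : NonZero q}} → x % q ≡ y % q → (x + p) % q ≡ (y + p) % q
%-cong-+ʳ {x} {y} p q x≡y = begin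
  (x + p) % q            ≡⟨ %-distribˡ-+ x p q ⟩
  (x % q + p % q) % q    ≡⟨ cong (λ r → (r + p % q) % q) x≡y ⟩
  (y % q + p % q) % q    ≡⟨ %-distribˡ-+ y p q ⟨
  (y + p) % q            ∎
  where open ≡-Reasoning

≤-half⇒+≤ : ∀ {m} n → m ≤ n / 2 → m + m ≤ n
≤-half⇒+≤ {m} n m≤n/2 = begin
  m + m        ≡⟨ cong (m +_) (+-identityʳ m) ⟨
  2 * m        ≡⟨ *-comm 2 m ⟩
  m * 2        ≤⟨ *-monoˡ-≤ 2 m≤n/2 ⟩
  (n / 2) * 2  ≤⟨ m/n*n≤m n 2 ⟩
  n            ∎
  where open ≤-Reasoning

module _ {a} {A : Set a} {n : ℕ} (u : Word A n) where

  period-iterate : ∀ {q} → HasPeriod u q →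
                   ∀ k (i j : Fin n) → toℕ j ≡ toℕ i + k * q → u i ≡ u j
  period-iterate u-q zero i j j≡i+0 =
    cong u (toℕ-injective (trans (sym (+-identityʳ (toℕ i))) (sym j≡i+0)))
  period-iterate {q} u-q (suc k) i j j≡i+kq+q =
    trans (period-iterate u-q k i mid (toℕ-fromℕ< mid<n)) (u-q mid j (begin
      toℕ j                ≡⟨ j≡i+kq+q ⟩
      toℕ i + (q + k * q)  ≡⟨ cong (toℕ i +_) (+-comm q (k * q)) ⟩
      toℕ i + (k * q + q)  ≡⟨ +-assoc (toℕ i) (k * q) q ⟨
      toℕ i + k * q + q    ≡⟨ cong (_+ q) (toℕ-fromℕ< mid<n) ⟨
      toℕ mid + q          ∎))
    where
    open ≡-Reasoning
    mid<n : toℕ i + k * q < n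
    mid<n = ≤-<-trans (≤-trans (m≤m+n (toℕ i + k * q) q)
            (≤-reflexive (trans (+-assoc (toℕ i) (k * q) q)
              (trans (cong (toℕ i +_) (+-comm (k * q) q)) (sym j≡i+kq+q)))))
            (toℕ<n j)
    mid : Fin n
    mid = fromℕ< mid<n

  period-mod : ∀ {q} .{{_ : NonZero q}} → HasPeriod u q →
               ∀ (i j : Fin n) → toℕ i % q ≡ toℕ j % q → u i ≡ u j
  period-mod {q} u-q i j i≡j = begin
    u i           ≡⟨ to-residue i ⟨
    u (residue i) ≡⟨ cong u (toℕ-injective (trans (toℕ-fromℕ< _) (trans i≡j (sym (toℕ-fromℕ< _))))) ⟩
    u (residue j) ≡⟨ to-residue j ⟩
    u j           ∎
    where
    open ≡-Reasoning
    residue : Fin n → Fin n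
    residue k = fromℕ< (≤-<-trans (m%n≤m (toℕ k) q) (toℕ<n k))
    to-residue : ∀ k → u (residue k) ≡ u k
    to-residue k = period-iterate u-q (toℕ k / q) (residue k) k
      (trans (m≡m%n+[m/n]*n (toℕ k) q) (cong (_+ (toℕ k / q) * q) (sym (toℕ-fromℕ< _))))

  periodicExtension : ∀ q .{{_ : NonZero q}} → q ≤ n → ℕ → A
  periodicExtension q q≤n x = u (fromℕ< (<-≤-trans (m%n<n x q) q≤n))

  module _ {q} .{{_ : NonZero q}} (q≤n : q ≤ n) where

    private
      E : ℕ → A
      E = periodicExtension q q≤n

    periodicExtension-mod : ∀ {x y} → x % q ≡ y % q → E x ≡ E y
    periodicExtension-mod x≡y = cong u (fromℕ<-cong _ _ x≡y _ _)

    periodicExtension-toℕ : HasPeriod u q → ∀ i → E (toℕ i) ≡ u i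
    periodicExtension-toℕ u-q i = period-mod u-q _ i
      (trans (cong (_% q) (toℕ-fromℕ< _)) (m%n%n≡m%n (toℕ i) q))

    periodicExtension-fromℕ< : HasPeriod u q → ∀ {x} (x<n : x < n) → E x ≡ u (fromℕ< x<n)
    periodicExtension-fromℕ< u-q {x} x<n =
      trans (cong E (sym (toℕ-fromℕ< x<n))) (periodicExtension-toℕ u-q (fromℕ< x<n))

module _ {a} {A : Set a} (c : ℕ → A) (p q : ℕ) .{{_ : NonZero q}}
         (c-mod : ∀ {x y} → x % q ≡ y % q → c x ≡ c y) (s : ℕ)
         (link : ∀ x → x % q ≢ s % q → c x ≡ c (x + p)) where

  -- Walk the orbit s + p, s + 2p, …, s + q p (residue of s) back to s + p: each
  -- step is a link, unless it already sits on the residue of s, where c equals c s.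
  private
    closes : ∀ k → c (s + p + k * p) ≡ c s → c (s + p) ≡ c s
    closes zero back = trans (cong c (sym (+-identityʳ (s + p)))) back
    closes (suc k) back with (s + p + k * p) % q ≟ s % q
    ... | yes same = closes k (c-mod same)
    ... | no other = closes k (trans (link _ other) (trans (cong c shift) back))
      where
      shift : s + p + k * p + p ≡ s + p + suc k * p
      shift = trans (+-assoc (s + p) (k * p) p) (cong (s + p +_) (+-comm (k * p) p))

  link-at-residue : c s ≡ c (s + p)
  link-at-residue = sym (closes (pred q) (c-mod (begin
    (s + p + pred q * p) % q   ≡⟨ cong (_% q) (+-assoc s p (pred q * p)) ⟩
    (s + suc (pred q) * p) % q ≡⟨ cong (λ k → (s + k * p) % q) (suc-pred q) ⟩
    (s + q * p) % q            ≡⟨ cong (λ k → (s + k) % q) (*-comm q p) ⟩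
    (s + p * q) % q            ≡⟨ [m+kn]%n≡m%n s p q ⟩
    s % q                      ∎)))
    where open ≡-Reasoning

  link-everywhere : ∀ x → c x ≡ c (x + p)
  link-everywhere x with x % q ≟ s % q
  ... | no other = link x other
  ... | yes same = trans (c-mod same) (trans link-at-residue (c-mod (%-cong-+ʳ p q (sym same))))

neighbour : ∀ {n} p .{{_ : NonZero p}} → p + p ≤ n → (t : Fin n) →
            Σ (Fin n) λ j → toℕ j ≡ toℕ t + p ⊎ toℕ t ≡ toℕ j + p
neighbour {n} p 2p≤n t with toℕ t + p <? n
... | yes t+p<n = fromℕ< t+p<n , inj₁ (toℕ-fromℕ< t+p<n)
... | no t+p≮n = fromℕ< t∸p<n , inj₂ (begin
  toℕ t                  ≡⟨ m∸n+n≡m p≤t ⟨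
  toℕ t ∸ p + p          ≡⟨ cong (_+ p) (toℕ-fromℕ< t∸p<n) ⟨
  toℕ (fromℕ< t∸p<n) + p ∎)
  where
  open ≡-Reasoning
  p≤t : p ≤ toℕ t
  p≤t = +-cancelʳ-≤ p p (toℕ t) (≤-trans 2p≤n (≮⇒≥ t+p≮n))
  t∸p<n : toℕ t ∸ p < n
  t∸p<n = ≤-<-trans (m∸n≤m (toℕ t) p) (toℕ<n t)

same-period-agree : ∀ {a} {A : Set a} {n p} .{{_ : NonZero p}} {w v : Word A n} →
  HasPeriod w p → HasPeriod v p → p + p ≤ n →
  (t : Fin n) → (∀ i → i ≢ t → w i ≡ v i) → w t ≡ v t
same-period-agree {p = p} w-p v-p 2p≤n t agree with neighbour p 2p≤n t
... | j , inj₁ j≡t+p = trans (w-p t j j≡t+p) (trans (agree j apart) (sym (v-p t j j≡t+p)))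
  where
  apart : j ≢ t
  apart refl = >⇒≢ (m<m+n (toℕ t) (>-nonZero⁻¹ p)) (sym j≡t+p)
... | j , inj₂ t≡j+p = trans (sym (w-p j t t≡j+p)) (trans (agree j apart) (v-p j t t≡j+p))
  where
  apart : j ≢ t
  apart refl = >⇒≢ (m<m+n (toℕ t) (>-nonZero⁻¹ p)) (sym t≡j+p)

module _ {a} {A : Set a} {n p q : ℕ} .{{_ : NonZero q}}
         {w v : Word A n} (w-q : HasPeriod w q) (v-p : HasPeriod v p)
         (t : Fin n) (agree : ∀ i → i ≢ t → w i ≡ v i)
         (p+q≤n : p + q ≤ n) (2q≤n : q + q ≤ n) where

  private
    T : ℕ
    T = toℕ t

    q≤n : q ≤ n
    q≤n = ≤-trans (m≤n+m q p) p+q≤n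

    E : ℕ → A
    E = periodicExtension w q q≤n

    avoids : ∀ {y} (y<n : y < n) → y ≢ T → fromℕ< y<n ≢ t
    avoids y<n y≢T eq = y≢T (trans (sym (toℕ-fromℕ< y<n)) (cong toℕ eq))

    link-through : ∀ x i → i % q ≡ x % q → i + p < n → i ≢ T → i + p ≢ T → E x ≡ E (x + p)
    link-through x i i≡x i+p<n i≢T i+p≢T = begin
      E x        ≡⟨ periodicExtension-mod w q≤n (sym i≡x) ⟩
      E i        ≡⟨ periodicExtension-fromℕ< w q≤n w-q i<n ⟩
      w I        ≡⟨ agree I (avoids i<n i≢T) ⟩
      v I        ≡⟨ v-p I J (trans (toℕ-fromℕ< i+p<n) (cong (_+ p) (sym (toℕ-fromℕ< i<n)))) ⟩
      v J        ≡⟨ agree J (avoids i+p<n i+p≢T) ⟨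
      w J        ≡⟨ periodicExtension-fromℕ< w q≤n w-q i+p<n ⟨
      E (i + p)  ≡⟨ periodicExtension-mod w q≤n (%-cong-+ʳ p q i≡x) ⟩
      E (x + p)  ∎
      where
      open ≡-Reasoning
      i<n : i < n
      i<n = ≤-<-trans (m≤m+n i p) i+p<n
      I J : Fin n
      I = fromℕ< i<n
      J = fromℕ< i+p<n

    -- A residue r is linked through r itself, or through r + q when r + p hits t.
    link-at : ∀ x → x % q ≢ T → (q ≤ T → x % q + p ≢ T) → E x ≡ E (x + p)
    link-at x r≢T r+p≢T-if-q≤T with x % q + p ≟ T
    ... | no r+p≢T = link-through x (x % q) (m%n%n≡m%n x q) r+p<n r≢T r+p≢T
      where
      r+p<n : x % q + p < n
      r+p<n = <-≤-trans (+-monoˡ-< p (m%n<n x q)) (≤-trans (≤-reflexive (+-comm q p)) p+q≤n)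
    ... | yes r+p≡T = link-through x (x % q + q)
            (trans ([m+n]%n≡m%n (x % q) q) (m%n%n≡m%n x q))
            (≤-<-trans (≤-reflexive r+q+p≡T+q) (<-≤-trans (+-monoˡ-< q T<q) 2q≤n))
            (>⇒≢ (<-≤-trans T<q (m≤n+m q (x % q))))
            (λ r+q+p≡T → >⇒≢ (m<m+n T (>-nonZero⁻¹ q)) (trans (sym r+q+p≡T+q) r+q+p≡T))
      where
      T<q : T < q
      T<q = ≰⇒> (λ q≤T → r+p≢T-if-q≤T q≤T r+p≡T)
      r+q+p≡T+q : x % q + q + p ≡ T + q
      r+q+p≡T+q = trans (+-assoc (x % q) q p) (trans (cong (x % q +_) (+-comm q p))
                    (trans (sym (+-assoc (x % q) p q)) (cong (_+ q) r+p≡T)))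

    all-links-but-one : Σ ℕ λ s → ∀ x → x % q ≢ s % q → E x ≡ E (x + p)
    all-links-but-one with T <? q
    ... | yes T<q = T , λ x x≢T → link-at x
          (λ r≡T → x≢T (trans r≡T (sym (m<n⇒m%n≡m T<q))))
          (λ q≤T → ⊥-elim (<⇒≱ T<q q≤T))
    ... | no T≮q = T ∸ p , λ x x≢s → link-at x
          (<⇒≢ (<-≤-trans (m%n<n x q) (≮⇒≥ T≮q)))
          (λ _ r+p≡T → x≢s (trans (sym (m%n%n≡m%n x q))
                            (cong (_% q) (trans (sym (m+n∸n≡m (x % q) p)) (cong (_∸ p) r+p≡T)))))

  period-transfer : HasPeriod w p
  period-transfer i j j≡i+p with all-links-but-one
  ... | s , links = begin
    w i             ≡⟨ periodicExtension-toℕ w q≤n w-q i ⟨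
    E (toℕ i)       ≡⟨ link-everywhere E p q (periodicExtension-mod w q≤n) s links (toℕ i) ⟩
    E (toℕ i + p)   ≡⟨ cong E (sym j≡i+p) ⟩
    E (toℕ j)       ≡⟨ periodicExtension-toℕ w q≤n w-q j ⟩
    w j             ∎
    where open ≡-Reasoning

proposition1 : ∀ {a} {A : Set a} (n p q : ℕ) → .{{NonZero p}} → .{{NonZero q}} →
    (w v : Word A n) → HasPeriod w q → HasPeriod v p →
    (t : Fin n) → ((i : Fin n) → ¬ (i ≡ t) → w i ≡ v i) →
    p ⊔ q ≤ n / 2 →
    (i : Fin n) → w i ≡ v i
proposition1 n p q w v w-q v-p t agree p⊔q≤n/2 i with i Fin.≟ t
... | no i≢t = agree i i≢t
... | yes refl = same-period-agree w-p v-p (fits p≤max p≤max) t agree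
  where
  p≤max : p ≤ p ⊔ q
  p≤max = m≤m⊔n p q
  q≤max : q ≤ p ⊔ q
  q≤max = m≤n⊔m p q
  fits : ∀ {x y} → x ≤ p ⊔ q → y ≤ p ⊔ q → x + y ≤ n
  fits x≤ y≤ = ≤-trans (+-mono-≤ x≤ y≤) (≤-half⇒+≤ n p⊔q≤n/2)
  w-p : HasPeriod w p
  w-p = period-transfer w-q v-p t agree (fits p≤max q≤max) (fits q≤max q≤max)
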